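{- Let $t\geq 2$ be an integer. There is a constant $D_t>0$ such that for every $n$ there is a $t$-program $P$ with $n$ atoms having at least $D_t\binom{2t-1}{t}^{n/(2t-1)}$ stable models.
   Context: A clause is $p\leftarrow B$ or $\leftarrow B$ (a constraint), where $p$ is an atom and $B$ is a finite set of literals (atoms $a$ or negated atoms $\mathrm{not}(a)$). A propositional logic program is a finite set of clauses; it is a $t$-program if every clause has at most $t$ literals, counting the head. $M\subseteq\mathit{At}(P)$ (the set of atoms of $P$) is a stable model of $P$ if $M$ satisfies all constraints of $P$ and is the least model of the Gelfond–Lifschitz reduct $P^M$, obtained by deleting every non-constraint clause with some $\mathrm{not}(a)$, $a\in M$, in its body and deleting negated literals from the remaining non-constraint clauses. -}

module Defs where

open import Data.Nat using (ℕ; _+_; _≤_)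
open import Data.Bool using (Bool; true; false; _∨_)
open import Data.Fin using (Fin)
open import Data.Fin.Subset using (Subset; _∈_; _∉_; _⊆_)
open import Data.Fin.Subset.Properties using (_∈?_)
open import Data.Maybe using (Maybe; just; nothing)
open import Data.List using (List; []; _∷_; length; mapMaybe)
open import Data.Bool.ListAction using (any)
open import Data.List.Relation.Unary.All using (All)
open import Data.List.Relation.Unary.Any using (Any)
open import Data.List.Membership.Propositional using () renaming (_∈_ to _∈ₗ_)
open import Data.Product using (_×_)
open import Data.Sum using (_⊎_)
open import Relation.Nullary using (¬_; does)
open import Relation.Binary.PropositionalEquality using (_≡_)

data Lit (n : ℕ) : Set where
  pos : Fin n → Lit n
  neg : Fin n → Lit n

-- A clause p ← B (head = just p) or a constraint ← B (head = nothing).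
-- The finite body set B is represented by a list.
record Clause (n : ℕ) : Set where
  constructor _⇐_
  field
    head : Maybe (Fin n)
    body : List (Lit n)
open Clause public

Program : ℕ → Set
Program n = List (Clause n)

headSize : ∀ {n} → Maybe (Fin n) → ℕ
headSize (just _) = 1
headSize nothing  = 0

clauseSize : ∀ {n} → Clause n → ℕ
clauseSize c = headSize (head c) + length (body c)

IsTProgram : ∀ {n} → ℕ → Program n → Set
IsTProgram t P = All (λ c → clauseSize c ≤ t) P

OccursIn : ∀ {n} → Fin n → Clause n → Set
OccursIn a c = (head c ≡ just a) ⊎ ((pos a ∈ₗ body c) ⊎ (neg a ∈ₗ body c))

-- At(P) is exactly the set of all n atoms
AtomsAll : ∀ {n} → Program n → Set
AtomsAll {n} P = (a : Fin n) → Any (OccursIn a) P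

Holds : ∀ {n} → Subset n → Lit n → Set
Holds M (pos a) = a ∈ M
Holds M (neg a) = a ∉ M

record DClause (n : ℕ) : Set where
  constructor _⇐ᵈ_
  field
    dhead : Fin n
    dbody : List (Fin n)
open DClause public

negIn : ∀ {n} → Subset n → Lit n → Bool
negIn M (pos a) = false
negIn M (neg a) = does (a ∈? M)

posAtom : ∀ {n} → Lit n → Maybe (Fin n)
posAtom (pos a) = just a
posAtom (neg a) = nothing

-- Gelfond–Lifschitz reduct P^M (constraints are dropped; they are checked separately)
reduct : ∀ {n} → Subset n → Program n → List (DClause n)
reduct M [] = []
reduct M ((nothing ⇐ B) ∷ P) = reduct M P
reduct M ((just h ⇐ B) ∷ P) with any (negIn M) B
... | true  = reduct M P
... | false = (h ⇐ᵈ mapMaybe posAtom B) ∷ reduct M P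

IsModel : ∀ {n} → Subset n → List (DClause n) → Set
IsModel M R = All (λ d → All (_∈ M) (dbody d) → dhead d ∈ M) R

IsLeastModel : ∀ {n} → Subset n → List (DClause n) → Set
IsLeastModel {n} M R = IsModel M R × ((M' : Subset n) → IsModel M' R → M ⊆ M')

SatConstraints : ∀ {n} → Subset n → Program n → Set
SatConstraints M P = All (λ c → head c ≡ nothing → ¬ All (Holds M) (body c)) P

IsStable : ∀ {n} → Program n → Subset n → Set
IsStable P M = SatConstraints M P × IsLeastModel M (reduct M P)

{-# OPTIONS --safe #-}
-- Let k = 2t − 1. For every t-element subset T of k atoms take the clauses
-- a ← not(x₁), …, not(x_{t−1}) for a ∈ T, where x₁, …, x_{t−1} list the complement of T;
-- each has t literals. The program is negative, so its stable models are its supported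
-- models. A clause of T fires in a t-subset S iff S ⊆ T, i.e. S = T, so every t-subset is
-- a stable model. Stable models of a disjoint union of programs are the products of stable
-- models, so ⌊n/k⌋ copies of this block plus n mod k atoms occurring in no clause have
-- C(k,t)^⌊n/k⌋ ≥ C(k,t)^(n/k) / (C(k,t) + 1) stable models.

module Submission where

open import Defs
open import Data.Nat using (ℕ; suc; _*_; _∸_; _^_; _≤_)
open import Data.Nat.Combinatorics using (_C_)
open import Data.Fin.Subset using (Subset)
open import Data.List using (List; length)
open import Data.List.Relation.Unary.All using (All)
open import Data.List.Relation.Unary.Unique.Propositional using (Unique)
open import Data.Product using (Σ; _×_; ∃)

open import Data.Nat using (zero; _+_; _<_; NonZero; s≤s)
open import Data.Nat.Properties
open import Data.Nat.DivMod using (_/_; _%_; m≡m%n+[m/n]*n; m%n<n)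
open import Data.Nat.Combinatorics using (nCk+nC[k+1]≡[n+1]C[k+1])
open import Data.Bool using (true; false)
open import Data.Bool.ListAction using (any)
open import Data.Fin using (Fin; _↑ˡ_; _↑ʳ_) renaming (zero to fzero; suc to fsuc)
open import Data.Fin.Subset using (_∈_; _∉_; _⊆_; ∁; ∣_∣; inside; outside) renaming (⊥ to ∅)
open import Data.Fin.Subset.Properties
  using (_∈?_; ∉⊥; ∣⊥∣≡0; ⊆-antisym; p⊂q⇒∣p∣<∣q∣; ∣∁p∣≡n∸∣p∣; x∈∁p⇒x∉p; x∉p⇒x∈∁p)
open import Data.Vec using ([]; _∷_; _++_; here; there)
open import Data.Vec.Properties using (∷-injectiveʳ; ++-injective)
open import Data.Maybe using (just; nothing)
open import Data.List using ([]; _∷_; map; mapMaybe; concatMap; allFin; cartesianProductWith)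
  renaming (_++_ to _++ₗ_)
open import Data.List.Properties using (length-++; length-map)
open import Data.List.Relation.Unary.All as All using ([]; _∷_)
import Data.List.Relation.Unary.All.Properties as All
open import Data.List.Relation.Unary.Any using (here; there)
open import Data.List.Relation.Unary.AllPairs using ([]; _∷_)
import Data.List.Relation.Unary.Unique.Propositional.Properties as Unique
open import Data.List.Membership.Propositional using (find; lose) renaming (_∈_ to _∈ₗ_)
open import Data.List.Membership.Propositional.Properties
  using (∈-map⁺; ∈-map⁻; ∈-++⁺ˡ; ∈-++⁺ʳ; ∈-++⁻; ∈-allFin; ∈-concatMap⁺; ∈-concatMap⁻; ∈-cartesianProductWith⁻)
open import Data.Product using (_,_; map₁; map₂)
open import Data.Sum using (inj₁; inj₂)
open import Relation.Nullary using (¬_; yes; no; contradiction)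
open import Relation.Nullary.Decidable using (decidable-stable)
open import Relation.Binary.PropositionalEquality
open import Function using (_∘_)

elements : ∀ {n} → Subset n → List (Fin n)
elements []            = []
elements (inside  ∷ p) = fzero ∷ map fsuc (elements p)
elements (outside ∷ p) = map fsuc (elements p)

∈-elements⁺ : ∀ {n} {p : Subset n} {x} → x ∈ p → x ∈ₗ elements p
∈-elements⁺ {p = inside  ∷ p} here        = here refl
∈-elements⁺ {p = inside  ∷ p} (there x∈p) = there (∈-map⁺ fsuc (∈-elements⁺ x∈p))
∈-elements⁺ {p = outside ∷ p} (there x∈p) = ∈-map⁺ fsuc (∈-elements⁺ x∈p)

∈-elements⁻ : ∀ {n} (p : Subset n) {x} → x ∈ₗ elements p → x ∈ p
∈-elements⁻ (inside  ∷ p) (here refl) = here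
∈-elements⁻ (inside  ∷ p) (there x∈) with ∈-map⁻ fsuc x∈
... | _ , y∈ , refl = there (∈-elements⁻ p y∈)
∈-elements⁻ (outside ∷ p) x∈ with ∈-map⁻ fsuc x∈
... | _ , y∈ , refl = there (∈-elements⁻ p y∈)

length-elements : ∀ {n} (p : Subset n) → length (elements p) ≡ ∣ p ∣
length-elements []            = refl
length-elements (inside  ∷ p) = cong suc (trans (length-map fsuc (elements p)) (length-elements p))
length-elements (outside ∷ p) = trans (length-map fsuc (elements p)) (length-elements p)

p⊆q∧∣p∣≡∣q∣⇒p≡q : ∀ {n} {p q : Subset n} → p ⊆ q → ∣ p ∣ ≡ ∣ q ∣ → p ≡ q
p⊆q∧∣p∣≡∣q∣⇒p≡q {p = p} {q} p⊆q ∣p∣≡∣q∣ = ⊆-antisym p⊆q q⊆p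
  where
  q⊆p : q ⊆ p
  q⊆p {x} x∈q = decidable-stable (x ∈? p) λ x∉p →
    <⇒≢ (p⊂q⇒∣p∣<∣q∣ (p⊆q , x , x∈q , x∉p)) ∣p∣≡∣q∣

subsetsOfSize : ∀ n → ℕ → List (Subset n)
subsetsOfSize n       zero    = ∅ ∷ []
subsetsOfSize zero    (suc t) = []
subsetsOfSize (suc n) (suc t) =
  map (inside ∷_) (subsetsOfSize n t) ++ₗ map (outside ∷_) (subsetsOfSize n (suc t))

length-subsetsOfSize : ∀ n t → length (subsetsOfSize n t) ≡ n C t
length-subsetsOfSize n       zero    = refl
length-subsetsOfSize zero    (suc t) = refl
length-subsetsOfSize (suc n) (suc t) = begin
  length (map (inside ∷_) (subsetsOfSize n t) ++ₗ map (outside ∷_) (subsetsOfSize n (suc t)))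
    ≡⟨ length-++ (map (inside ∷_) (subsetsOfSize n t)) ⟩
  length (map (inside ∷_) (subsetsOfSize n t)) + length (map (outside ∷_) (subsetsOfSize n (suc t)))
    ≡⟨ cong₂ _+_ (length-map _ (subsetsOfSize n t)) (length-map _ (subsetsOfSize n (suc t))) ⟩
  length (subsetsOfSize n t) + length (subsetsOfSize n (suc t))
    ≡⟨ cong₂ _+_ (length-subsetsOfSize n t) (length-subsetsOfSize n (suc t)) ⟩
  n C t + n C suc t
    ≡⟨ nCk+nC[k+1]≡[n+1]C[k+1] n t ⟩
  suc n C suc t ∎
  where open ≡-Reasoning

subsetsOfSize-unique : ∀ n t → Unique (subsetsOfSize n t)
subsetsOfSize-unique n       zero    = [] ∷ []
subsetsOfSize-unique zero    (suc t) = []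
subsetsOfSize-unique (suc n) (suc t) = Unique.++⁺
  (Unique.map⁺ ∷-injectiveʳ (subsetsOfSize-unique n t))
  (Unique.map⁺ ∷-injectiveʳ (subsetsOfSize-unique n (suc t)))
  disjoint
  where
  disjoint : ∀ {p} → ¬ (p ∈ₗ map (inside ∷_) (subsetsOfSize n t) ×
                        p ∈ₗ map (outside ∷_) (subsetsOfSize n (suc t)))
  disjoint (p∈ₗ , p∈ᵣ) with ∈-map⁻ (inside ∷_) p∈ₗ | ∈-map⁻ (outside ∷_) p∈ᵣ
  ... | _ , _ , refl | _ , _ , ()

∣∣-subsetsOfSize : ∀ n t {p} → p ∈ₗ subsetsOfSize n t → ∣ p ∣ ≡ t
∣∣-subsetsOfSize n       zero    (here refl) = ∣⊥∣≡0 n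
∣∣-subsetsOfSize (suc n) (suc t) p∈ with ∈-++⁻ (map (inside ∷_) (subsetsOfSize n t)) p∈
... | inj₁ p∈ₗ with ∈-map⁻ (inside ∷_) p∈ₗ
...   | _ , q∈ , refl = cong suc (∣∣-subsetsOfSize n t q∈)
∣∣-subsetsOfSize (suc n) (suc t) p∈ | inj₂ p∈ᵣ with ∈-map⁻ (outside ∷_) p∈ᵣ
...   | _ , q∈ , refl = ∣∣-subsetsOfSize n (suc t) q∈

Antichain : ∀ {n} → List (Subset n) → Set
Antichain 𝓣 = ∀ {S T} → S ∈ₗ 𝓣 → T ∈ₗ 𝓣 → S ⊆ T → S ≡ T

subsetsOfSize-antichain : ∀ n t → Antichain (subsetsOfSize n t)
subsetsOfSize-antichain n t S∈ T∈ S⊆T =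
  p⊆q∧∣p∣≡∣q∣⇒p≡q S⊆T (trans (∣∣-subsetsOfSize n t S∈) (sym (∣∣-subsetsOfSize n t T∈)))

record NegClause (n : ℕ) : Set where
  constructor _⇐¬_
  field
    nhead : Fin n
    nbody : List (Fin n)
open NegClause

module _ {n : ℕ} where

  Fires : Subset n → NegClause n → Set
  Fires M r = All (_∉ M) (nbody r)

  Closed : List (NegClause n) → Subset n → Set
  Closed R M = ∀ {r} → r ∈ₗ R → Fires M r → nhead r ∈ M

  Supported : List (NegClause n) → Subset n → Set
  Supported R M = ∀ {a} → a ∈ M → ∃ λ xs → (a ⇐¬ xs) ∈ₗ R × Fires M (a ⇐¬ xs)

  SupportedModel : List (NegClause n) → Subset n → Set
  SupportedModel R M = Closed R M × Supported R M

  IsTNegProgram : ℕ → List (NegClause n) → Set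
  IsTNegProgram t R = All (λ r → suc (length (nbody r)) ≤ t) R

subsetClauses : ∀ {n} → Subset n → List (NegClause n)
subsetClauses T = map (_⇐¬ elements (∁ T)) (elements T)

subsetProgram : ∀ {n} → List (Subset n) → List (NegClause n)
subsetProgram = concatMap subsetClauses

module _ {n : ℕ} {𝓣 : List (Subset n)} where

  ∈-subsetProgram⁺ : ∀ {T a} → T ∈ₗ 𝓣 → a ∈ T → (a ⇐¬ elements (∁ T)) ∈ₗ subsetProgram 𝓣
  ∈-subsetProgram⁺ T∈ a∈T = ∈-concatMap⁺ subsetClauses (lose T∈ (∈-map⁺ _ (∈-elements⁺ a∈T)))

  ∈-subsetProgram⁻ : ∀ {r} → r ∈ₗ subsetProgram 𝓣 →
                     ∃ λ T → ∃ λ a → T ∈ₗ 𝓣 × a ∈ T × r ≡ a ⇐¬ elements (∁ T)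
  ∈-subsetProgram⁻ r∈ with find (∈-concatMap⁻ subsetClauses {xs = 𝓣} r∈)
  ... | T , T∈ , r∈T with ∈-map⁻ _ r∈T
  ...   | a , a∈ , r≡ = T , a , T∈ , ∈-elements⁻ T a∈ , r≡

  antichain-supportedModel : Antichain 𝓣 → ∀ {M} → M ∈ₗ 𝓣 → SupportedModel (subsetProgram 𝓣) M
  antichain-supportedModel antichain {M} M∈ = closed , supported
    where
    closed : Closed (subsetProgram 𝓣) M
    closed r∈ fires with ∈-subsetProgram⁻ r∈
    ... | T , a , T∈ , a∈T , refl = subst (a ∈_) (sym (antichain M∈ T∈ M⊆T)) a∈T
      where
      M⊆T : M ⊆ T
      M⊆T {x} x∈M = decidable-stable (x ∈? T) λ x∉T →
        All.lookup fires (∈-elements⁺ (x∉p⇒x∈∁p x∉T)) x∈M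
    supported : Supported (subsetProgram 𝓣) M
    supported a∈M = elements (∁ M) , ∈-subsetProgram⁺ M∈ a∈M ,
                    All.tabulate (λ x∈ → x∈∁p⇒x∉p (∈-elements⁻ (∁ M) x∈))

subsetsOfSize-isTNegProgram : ∀ n t → IsTNegProgram (suc (n ∸ t)) (subsetProgram (subsetsOfSize n t))
subsetsOfSize-isTNegProgram n t = All.tabulate size
  where
  size : ∀ {r} → r ∈ₗ subsetProgram (subsetsOfSize n t) → suc (length (nbody r)) ≤ suc (n ∸ t)
  size r∈ with ∈-subsetProgram⁻ r∈
  ... | T , _ , T∈ , _ , refl = s≤s (≤-reflexive (begin
    length (elements (∁ T)) ≡⟨ length-elements (∁ T) ⟩
    ∣ ∁ T ∣                 ≡⟨ ∣∁p∣≡n∸∣p∣ T ⟩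
    n ∸ ∣ T ∣               ≡⟨ cong (n ∸_) (∣∣-subsetsOfSize n t T∈) ⟩
    n ∸ t                   ∎))
    where open ≡-Reasoning

module _ {n : ℕ} where

  toClause : NegClause n → Clause n
  toClause (h ⇐¬ xs) = just h ⇐ map neg xs

  nonContradiction : Fin n → Clause n
  nonContradiction a = nothing ⇐ (pos a ∷ neg a ∷ [])

  -- The constraints ← a, not(a) hold in every interpretation; they only make every atom occur in P.
  program : List (NegClause n) → Program n
  program R = map toClause R ++ₗ map nonContradiction (allFin n)

  Unblocked : Subset n → List (Lit n) → Set
  Unblocked M B = any (negIn M) B ≡ false

  ∈-reduct⁺ : ∀ M (P : Program n) {h B} → (just h ⇐ B) ∈ₗ P → Unblocked M B →
              (h ⇐ᵈ mapMaybe posAtom B) ∈ₗ reduct M P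
  ∈-reduct⁺ M ((just h ⇐ B) ∷ P)   (here refl) unblocked rewrite unblocked = here refl
  ∈-reduct⁺ M ((nothing ⇐ B) ∷ P)  (there c∈)  unblocked = ∈-reduct⁺ M P c∈ unblocked
  ∈-reduct⁺ M ((just h′ ⇐ B′) ∷ P) (there c∈)  unblocked with any (negIn M) B′
  ... | true  = ∈-reduct⁺ M P c∈ unblocked
  ... | false = there (∈-reduct⁺ M P c∈ unblocked)

  ∈-reduct⁻ : ∀ M (P : Program n) {d} → d ∈ₗ reduct M P →
              ∃ λ B → (just (dhead d) ⇐ B) ∈ₗ P × Unblocked M B
  ∈-reduct⁻ M ((nothing ⇐ B) ∷ P) d∈ = map₂ (map₁ there) (∈-reduct⁻ M P d∈)
  ∈-reduct⁻ M ((just h ⇐ B) ∷ P) d∈ with any (negIn M) B in unblocked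
  ... | true = map₂ (map₁ there) (∈-reduct⁻ M P d∈)
  ... | false with d∈
  ...   | here refl = B , here refl , unblocked
  ...   | there d∈′ = map₂ (map₁ there) (∈-reduct⁻ M P d∈′)

  All∉⇒unblocked : ∀ M xs → All (_∉ M) xs → Unblocked M (map neg xs)
  All∉⇒unblocked M []       []           = refl
  All∉⇒unblocked M (x ∷ xs) (x∉M ∷ xs∉M) with x ∈? M
  ... | yes x∈M = contradiction x∈M x∉M
  ... | no  _   = All∉⇒unblocked M xs xs∉M

  unblocked⇒All∉ : ∀ M xs → Unblocked M (map neg xs) → All (_∉ M) xs
  unblocked⇒All∉ M []       _         = []
  unblocked⇒All∉ M (x ∷ xs) unblocked with x ∈? M
  ... | no x∉M = x∉M ∷ unblocked⇒All∉ M xs unblocked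

  posAtoms-map-neg : (xs : List (Fin n)) → mapMaybe posAtom (map neg xs) ≡ []
  posAtoms-map-neg []       = refl
  posAtoms-map-neg (x ∷ xs) = posAtoms-map-neg xs

  supportedModel⇒stable : ∀ {R M} → SupportedModel R M → IsStable (program R) M
  supportedModel⇒stable {R} {M} (closed , supported) = All.tabulate constraint , model , least
    where
    constraint : ∀ {c} → c ∈ₗ program R → head c ≡ nothing → ¬ All (Holds M) (body c)
    constraint c∈ with ∈-++⁻ (map toClause R) c∈
    ... | inj₁ c∈ₗ with ∈-map⁻ toClause c∈ₗ
    ...   | _ , _ , refl = λ ()
    constraint c∈ | inj₂ c∈ᵣ with ∈-map⁻ nonContradiction c∈ᵣ
    ...   | _ , _ , refl = λ { _ (a∈M ∷ a∉M ∷ []) → a∉M a∈M }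
    derived : ∀ {h B} → (just h ⇐ B) ∈ₗ program R → Unblocked M B → h ∈ M
    derived c∈ unblocked with ∈-++⁻ (map toClause R) c∈
    ... | inj₁ c∈ₗ with ∈-map⁻ toClause c∈ₗ
    ...   | (_ ⇐¬ xs) , r∈ , refl = closed r∈ (unblocked⇒All∉ M xs unblocked)
    derived c∈ _ | inj₂ c∈ᵣ with ∈-map⁻ nonContradiction c∈ᵣ
    ...   | _ , _ , ()
    model : IsModel M (reduct M (program R))
    model = All.tabulate λ d∈ _ →
      let _ , c∈ , unblocked = ∈-reduct⁻ M (program R) d∈ in derived c∈ unblocked
    least : ∀ M′ → IsModel M′ (reduct M (program R)) → M ⊆ M′
    least M′ model′ {a} a∈M with supported a∈M
    ... | xs , r∈ , fires = All.lookup model′ d∈ (subst (All (_∈ M′)) (sym (posAtoms-map-neg xs)) [])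
      where
      d∈ : (a ⇐ᵈ mapMaybe posAtom (map neg xs)) ∈ₗ reduct M (program R)
      d∈ = ∈-reduct⁺ M (program R) (∈-++⁺ˡ (∈-map⁺ toClause r∈)) (All∉⇒unblocked M xs fires)

  program-isTProgram : ∀ {t R} → 2 ≤ t → IsTNegProgram t R → IsTProgram t (program R)
  program-isTProgram {t} 2≤t R-small =
    All.++⁺ (All.map⁺ (All.map (λ {r} → clause-size {r}) R-small)) (All.map⁺ (All.tabulate λ _ → 2≤t))
    where
    clause-size : ∀ {r} → suc (length (nbody r)) ≤ t → clauseSize (toClause r) ≤ t
    clause-size {r} = subst (λ l → suc l ≤ t) (sym (length-map neg (nbody r)))

  program-atomsAll : ∀ R → AtomsAll (program R)
  program-atomsAll R a =
    lose (∈-++⁺ʳ (map toClause R) (∈-map⁺ nonContradiction (∈-allFin a))) (inj₂ (inj₁ (here refl)))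

rename : ∀ {k m} → (Fin k → Fin m) → NegClause k → NegClause m
rename f (h ⇐¬ xs) = f h ⇐¬ map f xs

rename-isTNegProgram : ∀ {k m t} {f : Fin k → Fin m} {R} →
                       IsTNegProgram t R → IsTNegProgram t (map (rename f) R)
rename-isTNegProgram {t = t} {f} =
  All.map⁺ ∘ All.map λ {r} → subst (λ l → suc l ≤ t) (sym (length-map f (nbody r)))

data SplitView (k N : ℕ) : Fin (k + N) → Set where
  left  : (i : Fin k) → SplitView k N (i ↑ˡ N)
  right : (j : Fin N) → SplitView k N (k ↑ʳ j)

splitView : ∀ k {N} (a : Fin (k + N)) → SplitView k N a
splitView zero    a        = right a
splitView (suc k) fzero    = left fzero
splitView (suc k) (fsuc a) with splitView k a
... | left  i = left (fsuc i)
... | right j = right j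

∈-↑ˡ⁺ : ∀ {k N} {p : Subset k} {q : Subset N} {i} → i ∈ p → (i ↑ˡ N) ∈ (p ++ q)
∈-↑ˡ⁺ here        = here
∈-↑ˡ⁺ (there i∈p) = there (∈-↑ˡ⁺ i∈p)

∈-↑ˡ⁻ : ∀ {k N} (p : Subset k) {q : Subset N} i → (i ↑ˡ N) ∈ (p ++ q) → i ∈ p
∈-↑ˡ⁻ (_ ∷ p) fzero    here        = here
∈-↑ˡ⁻ (_ ∷ p) (fsuc i) (there i∈p) = there (∈-↑ˡ⁻ p i i∈p)

∈-↑ʳ⁺ : ∀ {k N} (p : Subset k) {q : Subset N} {j} → j ∈ q → (k ↑ʳ j) ∈ (p ++ q)
∈-↑ʳ⁺ []      j∈q = j∈q
∈-↑ʳ⁺ (_ ∷ p) j∈q = there (∈-↑ʳ⁺ p j∈q)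

∈-↑ʳ⁻ : ∀ {k N} (p : Subset k) {q : Subset N} {j} → (k ↑ʳ j) ∈ (p ++ q) → j ∈ q
∈-↑ʳ⁻ []      j∈q         = j∈q
∈-↑ʳ⁻ (_ ∷ p) (there j∈q) = ∈-↑ʳ⁻ p j∈q

module _ {k N : ℕ} where

  liftˡ : NegClause k → NegClause (k + N)
  liftˡ = rename (_↑ˡ N)

  liftʳ : NegClause N → NegClause (k + N)
  liftʳ = rename (k ↑ʳ_)

  _⊕_ : List (NegClause k) → List (NegClause N) → List (NegClause (k + N))
  R ⊕ S = map liftˡ R ++ₗ map liftʳ S

  ⊕-closed : ∀ {R S p q} → Closed R p → Closed S q → Closed (R ⊕ S) (p ++ q)
  ⊕-closed {R} {S} {p} {q} R-closed S-closed r∈ fires with ∈-++⁻ (map liftˡ R) r∈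
  ... | inj₁ r∈ₗ with ∈-map⁻ liftˡ r∈ₗ
  ...   | _ , r∈R , refl =
    ∈-↑ˡ⁺ (R-closed r∈R (All.map (λ i∉ i∈ → i∉ (∈-↑ˡ⁺ i∈)) (All.map⁻ fires)))
  ⊕-closed {R} {S} {p} {q} R-closed S-closed r∈ fires | inj₂ r∈ᵣ with ∈-map⁻ liftʳ r∈ᵣ
  ...   | _ , r∈S , refl =
    ∈-↑ʳ⁺ p (S-closed r∈S (All.map (λ j∉ j∈ → j∉ (∈-↑ʳ⁺ p j∈)) (All.map⁻ fires)))

  ⊕-supported : ∀ {R S p q} → Supported R p → Supported S q → Supported (R ⊕ S) (p ++ q)
  ⊕-supported {R} {S} {p} {q} R-supported S-supported {a} a∈ = support (splitView k a) a∈
    where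
    support : ∀ {a} → SplitView k N a → a ∈ (p ++ q) →
              ∃ λ xs → (a ⇐¬ xs) ∈ₗ (R ⊕ S) × Fires (p ++ q) (a ⇐¬ xs)
    support (left i) i∈ with R-supported (∈-↑ˡ⁻ p i i∈)
    ... | xs , r∈ , fires = map (_↑ˡ N) xs , ∈-++⁺ˡ (∈-map⁺ liftˡ r∈) ,
                            All.map⁺ (All.map (λ {x} x∉ x∈ → x∉ (∈-↑ˡ⁻ p x x∈)) fires)
    support (right j) j∈ with S-supported (∈-↑ʳ⁻ p j∈)
    ... | xs , r∈ , fires = map (k ↑ʳ_) xs , ∈-++⁺ʳ (map liftˡ R) (∈-map⁺ liftʳ r∈) ,
                            All.map⁺ (All.map (λ x∉ x∈ → x∉ (∈-↑ʳ⁻ p x∈)) fires)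

  ⊕-isTNegProgram : ∀ {t R S} → IsTNegProgram t R → IsTNegProgram t S → IsTNegProgram t (R ⊕ S)
  ⊕-isTNegProgram R-small S-small = All.++⁺ (rename-isTNegProgram R-small) (rename-isTNegProgram S-small)

record ModelFamily (t n L : ℕ) : Set where
  field
    clauses   : List (NegClause n)
    models    : List (Subset n)
    small     : IsTNegProgram t clauses
    distinct  : Unique models
    supported : All (SupportedModel clauses) models
    count     : length models ≡ L
open ModelFamily

emptyFamily : ∀ t n → ModelFamily t n 1
emptyFamily t n = record
  { clauses   = []
  ; models    = ∅ ∷ []
  ; small     = []
  ; distinct  = [] ∷ []
  ; supported = ((λ ()) , λ a∈∅ → contradiction a∈∅ ∉⊥) ∷ []
  ; count     = refl
  }

subsetsOfSizeFamily : ∀ n t → ModelFamily (suc (n ∸ t)) n (n C t)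
subsetsOfSizeFamily n t = record
  { clauses   = subsetProgram (subsetsOfSize n t)
  ; models    = subsetsOfSize n t
  ; small     = subsetsOfSize-isTNegProgram n t
  ; distinct  = subsetsOfSize-unique n t
  ; supported = All.tabulate (antichain-supportedModel (subsetsOfSize-antichain n t))
  ; count     = length-subsetsOfSize n t
  }

widen : ∀ {t t′ n L} → t ≤ t′ → ModelFamily t n L → ModelFamily t′ n L
widen t≤t′ F = record
  { clauses   = clauses F
  ; models    = models F
  ; small     = All.map (λ small → ≤-trans small t≤t′) (small F)
  ; distinct  = distinct F
  ; supported = supported F
  ; count     = count F
  }

length-cartesianProductWith : ∀ {A B C : Set} (f : A → B → C) xs ys →
                              length (cartesianProductWith f xs ys) ≡ length xs * length ys
length-cartesianProductWith f []       ys = refl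
length-cartesianProductWith f (x ∷ xs) ys = trans (length-++ (map (f x) ys))
  (cong₂ _+_ (length-map (f x) ys) (length-cartesianProductWith f xs ys))

_⊗_ : ∀ {t k N a b} → ModelFamily t k a → ModelFamily t N b → ModelFamily t (k + N) (a * b)
F ⊗ G = record
  { clauses   = clauses F ⊕ clauses G
  ; models    = cartesianProductWith _++_ (models F) (models G)
  ; small     = ⊕-isTNegProgram (small F) (small G)
  ; distinct  = Unique.cartesianProductWith⁺ _++_ (λ {w} {x} → ++-injective w x) (distinct F) (distinct G)
  ; supported = All.tabulate product-supported
  ; count     = trans (length-cartesianProductWith _++_ (models F) (models G))
                      (cong₂ _*_ (count F) (count G))
  }
  where
  product-supported : ∀ {v} → v ∈ₗ cartesianProductWith _++_ (models F) (models G) →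
                      SupportedModel (clauses F ⊕ clauses G) v
  product-supported v∈ with ∈-cartesianProductWith⁻ _++_ (models F) (models G) v∈
  ... | _ , _ , p∈ , q∈ , refl with All.lookup (supported F) p∈ | All.lookup (supported G) q∈
  ...   | p-closed , p-supported | q-closed , q-supported =
    ⊕-closed p-closed q-closed , ⊕-supported p-supported q-supported

power : ∀ {t k a} m → ModelFamily t k a → ModelFamily t (m * k) (a ^ m)
power {t} zero    F = emptyFamily t 0
power     (suc m) F = F ⊗ power m F

tile : ∀ {t k a} n → .{{_ : NonZero k}} → ModelFamily t k a → ModelFamily t n (a ^ (n / k))
tile {t} {k} {a} n F = subst₂ (ModelFamily t) (sym (m≡m%n+[m/n]*n n k)) (*-identityˡ (a ^ (n / k)))
  (emptyFamily t (n % k) ⊗ power (n / k) F)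

^-distrib-* : ∀ a b m → (a * b) ^ m ≡ a ^ m * b ^ m
^-distrib-* a b zero    = refl
^-distrib-* a b (suc m) =
  trans (cong ((a * b) *_) (^-distrib-* a b m)) ([m*n]*[o*p]≡[m*o]*[n*p] a b (a ^ m) (b ^ m))

a^n≤[a^[n/k]*[1+a]]^k : ∀ a n k .{{_ : NonZero k}} → a ^ n ≤ (a ^ (n / k) * suc a) ^ k
a^n≤[a^[n/k]*[1+a]]^k a n k = begin
  a ^ n                         ≡⟨ cong (a ^_) (m≡m%n+[m/n]*n n k) ⟩
  a ^ (n % k + n / k * k)       ≡⟨ ^-distribˡ-+-* a (n % k) (n / k * k) ⟩
  a ^ (n % k) * a ^ (n / k * k) ≤⟨ *-monoˡ-≤ (a ^ (n / k * k)) remainder ⟩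
  suc a ^ k * a ^ (n / k * k)   ≡⟨ cong (suc a ^ k *_) (sym (^-*-assoc a (n / k) k)) ⟩
  suc a ^ k * (a ^ (n / k)) ^ k ≡⟨ *-comm (suc a ^ k) _ ⟩
  (a ^ (n / k)) ^ k * suc a ^ k ≡⟨ ^-distrib-* (a ^ (n / k)) (suc a) k ⟨
  (a ^ (n / k) * suc a) ^ k     ∎
  where
  open ≤-Reasoning
  remainder : a ^ (n % k) ≤ suc a ^ k
  remainder = ≤-trans (^-monoˡ-≤ (n % k) (n≤1+n a)) (^-monoʳ-≤ (suc a) (<⇒≤ (m%n<n n k)))

2*t∸1<t+t : ∀ t .{{_ : NonZero t}} → 2 * t ∸ 1 < t + t
2*t∸1<t+t (suc t) = s≤s (≤-reflexive (cong (λ x → t + suc x) (+-identityʳ t)))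

theorem4 : (t : ℕ) → 2 ≤ t →
    Σ ℕ λ p → Σ ℕ λ q →
      (n : ℕ) → Σ (Program n) λ P →
        IsTProgram t P × AtomsAll P ×
        Σ (List (Subset n)) λ Ms →
          Unique Ms × All (IsStable P) Ms ×
          (suc p ^ (2 * t ∸ 1)) * (((2 * t ∸ 1) C t) ^ n)
            ≤ (length Ms * suc q) ^ (2 * t ∸ 1)
theorem4 (suc zero) (s≤s ())
theorem4 t@(suc (suc _)) 2≤t = 0 , k C t , λ n → let F = family n in
  program (clauses F) , program-isTProgram 2≤t (small F) , program-atomsAll (clauses F) ,
  models F , distinct F , All.map supportedModel⇒stable (supported F) , bound n (models F) (count F)
  where
  k : ℕ
  k = 2 * t ∸ 1
  family : ∀ n → ModelFamily t n ((k C t) ^ (n / k))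
  family n = tile n (widen (m<n+o⇒m∸n<o k t (2*t∸1<t+t t)) (subsetsOfSizeFamily k t))
  bound : ∀ n (Ms : List (Subset n)) → length Ms ≡ (k C t) ^ (n / k) →
          1 ^ k * (k C t) ^ n ≤ (length Ms * suc (k C t)) ^ k
  bound n Ms count rewrite count = begin
    1 ^ k * (k C t) ^ n ≡⟨ cong (_* (k C t) ^ n) (^-zeroˡ k) ⟩
    1 * (k C t) ^ n     ≡⟨ *-identityˡ _ ⟩
    (k C t) ^ n         ≤⟨ a^n≤[a^[n/k]*[1+a]]^k (k C t) n k ⟩
    ((k C t) ^ (n / k) * suc (k C t)) ^ k ∎
    where open ≤-Reasoning
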